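{- Let $\widetilde{c}$ be the reversed sequence defined by $\widetilde{c}_n = c_{ -n-1}$ for all $n \in \mathbb{Z}$. For the doubly infinite sequence $\mathcal{F} = \big( (x\,|\,c)^{n} \big)_{n \in \mathbb{Z}}$, the double dual sequence $\check{\mathcal{F}} = (\check{f}_n(v))_{n \ge 0}$ is given by $\check{f}_0(v) = 1$ and $\check{f}_n(v) = v\,(v\,|\,\widetilde{c})^{n-1}$ for $n > 0$. Equivalently, \[ \sum_{n=0}^{\infty} (x\,|\,c)^{ -n}\, \check{f}_n(v) = \frac{1}{1 - x^{ -1} v}. \]
   Context: Let $c = (c_n)_{n \in \mathbb{Z}}$ be a doubly infinite sequence of indeterminates. Factorial powers are defined by $(x\,|\,c)^{n} = (x - c_0)(x - c_1)\cdots(x - c_{n-1})$ for $n \ge 0$ (with $(x\,|\,c)^0 = 1$), and $(x\,|\,c)^{ -n} = \dfrac{1}{(x - c_{ -1})(x - c_{ -2})\cdots(x - c_{ -n})}$ for $n > 0$; the latter is a formal power series in $x^{ -1}$ of order $n$. Given a doubly infinite sequence $\mathcal{F} = (f_n(x))_{n \in \mathbb{Z}}$ where $(f_n)_{n\ge 0}$ are monic polynomials of degree $n$ with $f_0 = 1$, and $f_{ -n}(x)$ ($n>0$) is a formal power series in $x^{ -1}$ of order $n$, its double dual is the unique sequence of polynomials $\check{f}_n(v)$, $\check{f}_n$ of degree $n$ ($n \ge 0$), such that $\sum_{n=0}^{\infty} f_{ -n}(x)\,\check{f}_n(v) = \dfrac{1}{1 - x^{ -1} v}$. Here $\check{f}_n$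 denotes the $n$-th term of the double dual sequence. -}

module Defs where

open import Level using (Level)
open import Algebra.Bundles using (CommutativeRing)
open import Data.Nat using (ℕ; zero; suc; _∸_)
open import Data.Integer using (ℤ; -[1+_])

-- Formal power series in the variable y = x⁻¹ with coefficients in a
-- commutative ring R, represented by their coefficient sequences.
module FPS {a ℓ : Level} (R : CommutativeRing a ℓ) where
  open CommutativeRing R

  Series : Set a
  Series = ℕ → Carrier

  sumTo : (ℕ → Carrier) → ℕ → Carrier
  sumTo f zero    = 0#
  sumTo f (suc n) = sumTo f n + f n

  pow : Carrier → ℕ → Carrier
  pow b zero    = 1#
  pow b (suc n) = b * pow b n

  oneS : Series
  oneS zero    = 1#
  oneS (suc _) = 0#

  _⊛_ : Series → Series → Series
  (f ⊛ g) k = sumTo (λ i → f i * g (k ∸ i)) (suc k)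

  shiftY : Series → Series
  shiftY f zero    = 0#
  shiftY f (suc k) = f k

  -- 1 / (1 - b y) = Σ_m b^m y^m
  geom : Carrier → Series
  geom b k = pow b k

  -- 1 / (x - b) = y / (1 - b y)  as a power series in y = x⁻¹
  invXminus : Carrier → Series
  invXminus b = shiftY (geom b)

  -- negative factorial powers:
  -- (x | c)^{-n} = 1 / ((x - c_{-1}) (x - c_{-2}) ⋯ (x - c_{-n}))
  -- (c_{-(i+1)} is  c -[1+ i ])
  negFact : (ℤ → Carrier) → ℕ → Series
  negFact c zero    = oneS
  negFact c (suc n) = negFact c n ⊛ invXminus (c -[1+ n ])

  rev : (ℤ → Carrier) → ℕ → Carrier
  rev c j = c -[1+ j ]

  posFact : (ℕ → Carrier) → Carrier → ℕ → Carrier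
  posFact d v zero    = 1#
  posFact d v (suc n) = posFact d v n * (v - d n)

  fcheck : (ℤ → Carrier) → Carrier → ℕ → Carrier
  fcheck c v zero    = 1#
  fcheck c v (suc n) = v * posFact (rev c) v n

  -- Σ_{n ≥ 0} F n, for a family where F n has order ≥ n in y,
  -- so the coefficient of y^k only involves n ≤ k.
  sumOrd : (ℕ → Series) → Series
  sumOrd F k = sumTo (λ n → F n k) (suc k)

  lhsSeries : (ℤ → Carrier) → Carrier → Series
  lhsSeries c v = sumOrd (λ n k → negFact c n k * fcheck c v n)

-- Reading the identity coefficientwise in y = x⁻¹, write S_k for the coefficient of y^k
-- on the left.  Dividing a series by x − b is the recursion g_{k+1} = f_k + b g_k, so the
-- coefficients of (x | c)^{-(n+1)} satisfy A_{n+1,k+1} = A_{n,k} + c̃_n A_{n+1,k}.  The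
-- double dual satisfies the matching recursion f̌_{n+2} + c̃_n f̌_{n+1} = v f̌_{n+1} (and
-- f̌_1 = v f̌_0), so after reindexing the c̃_n-terms cancel and S_{k+1} = v S_k, with S_0 = 1.
module Submission where

open import Defs
open import Level using (Level)
open import Algebra.Bundles using (CommutativeRing)
import Algebra.Properties.CommutativeSemigroup as CommutativeSemigroupProperties
open import Data.Nat using (ℕ; zero; suc; _∸_; _<_; s≤s)
open import Data.Nat.Properties using (n∸n≡0; m+n∸n≡m; n<1+n; m<n⇒m<1+n)
open import Data.Integer using (ℤ)
open import Relation.Binary.PropositionalEquality using (cong)

module _ {a ℓ : Level} (R : CommutativeRing a ℓ) where
  open CommutativeRing R
  open FPS R
  open import Relation.Binary.Reasoning.Setoid setoid
  open CommutativeSemigroupProperties +-commutativeSemigroup using (interchange)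
  open CommutativeSemigroupProperties *-commutativeSemigroup using (x∙yz≈y∙xz; xy∙z≈y∙xz)

  minus-+-cancel : ∀ x y → (x - y) + y ≈ x
  minus-+-cancel x y = trans (+-assoc x (- y) y) (trans (+-congˡ (-‿inverseˡ y)) (+-identityʳ x))

  sumTo-cong : ∀ {f g} n → (∀ i → i < n → f i ≈ g i) → sumTo f n ≈ sumTo g n
  sumTo-cong zero    f≈g = refl
  sumTo-cong (suc n) f≈g =
    +-cong (sumTo-cong n (λ i i<n → f≈g i (m<n⇒m<1+n i<n))) (f≈g n (n<1+n n))

  sumTo-+ : ∀ f g n → sumTo (λ i → f i + g i) n ≈ sumTo f n + sumTo g n
  sumTo-+ f g zero    = sym (+-identityˡ 0#)
  sumTo-+ f g (suc n) = trans (+-congʳ (sumTo-+ f g n)) (interchange _ _ _ _)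

  *-distribˡ-sumTo : ∀ x f n → x * sumTo f n ≈ sumTo (λ i → x * f i) n
  *-distribˡ-sumTo x f zero    = zeroʳ x
  *-distribˡ-sumTo x f (suc n) = trans (distribˡ x _ _) (+-congʳ (*-distribˡ-sumTo x f n))

  sumTo-suc-head : ∀ f n → sumTo f (suc n) ≈ f 0 + sumTo (λ i → f (suc i)) n
  sumTo-suc-head f zero    = +-comm 0# (f 0)
  sumTo-suc-head f (suc n) = trans (+-congʳ (sumTo-suc-head f n)) (+-assoc _ _ _)

  sumTo-drop-last : ∀ f n → f n ≈ 0# → sumTo f (suc n) ≈ sumTo f n
  sumTo-drop-last f n fn≈0 = trans (+-congˡ fn≈0) (+-identityʳ _)

  invXminus-∸-suc : ∀ b {k} i → i < k → invXminus b (suc k ∸ i) ≈ b * invXminus b (k ∸ i)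
  invXminus-∸-suc b {suc k} zero    _         = refl
  invXminus-∸-suc b {suc k} (suc i) (s≤s i<k) = invXminus-∸-suc b i i<k

  module _ (f : Series) (b : Carrier) where
    private
      term : ℕ → ℕ → Carrier
      term k i = f i * invXminus b (k ∸ i)

    ⊛-invXminus-truncate : ∀ k → (f ⊛ invXminus b) k ≈ sumTo (term k) k
    ⊛-invXminus-truncate k =
      sumTo-drop-last (term k) k (trans (*-congˡ (reflexive (cong (invXminus b) (n∸n≡0 k)))) (zeroʳ _))

    ⊛-invXminus-zero : (f ⊛ invXminus b) 0 ≈ 0#
    ⊛-invXminus-zero = ⊛-invXminus-truncate 0

    -- (x − b) · (f / (x − b)) = f, read off coefficientwise
    ⊛-invXminus-suc : ∀ k → (f ⊛ invXminus b) (suc k) ≈ f k + b * (f ⊛ invXminus b) k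
    ⊛-invXminus-suc k = begin
      (f ⊛ invXminus b) (suc k)
        ≈⟨ ⊛-invXminus-truncate (suc k) ⟩
      sumTo (term (suc k)) k + f k * invXminus b (suc k ∸ k)
        ≈⟨ +-cong (sumTo-cong k (λ i i<k → trans (*-congˡ (invXminus-∸-suc b i i<k)) (x∙yz≈y∙xz _ _ _)))
                  (trans (*-congˡ (reflexive (cong (invXminus b) (m+n∸n≡m 1 k)))) (*-identityʳ _)) ⟩
      sumTo (λ i → b * term k i) k + f k
        ≈⟨ +-comm _ _ ⟩
      f k + sumTo (λ i → b * term k i) k
        ≈⟨ +-congˡ (sym (trans (*-congˡ (⊛-invXminus-truncate k)) (*-distribˡ-sumTo b (term k) k))) ⟩
      f k + b * (f ⊛ invXminus b) k ∎

  negFact-suc-suc : ∀ c n k → negFact c (suc n) (suc k) ≈ negFact c n k + rev c n * negFact c (suc n) k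
  negFact-suc-suc c n = ⊛-invXminus-suc (negFact c n) (rev c n)

  negFact-order : ∀ c {n k} → k < n → negFact c n k ≈ 0#
  negFact-order c {suc n} {zero}  _         = ⊛-invXminus-zero (negFact c n) (rev c n)
  negFact-order c {suc n} {suc k} (s≤s k<n) = begin
    negFact c (suc n) (suc k)                          ≈⟨ negFact-suc-suc c n k ⟩
    negFact c n k + rev c n * negFact c (suc n) k      ≈⟨ +-cong (negFact-order c k<n)
                                                            (*-congˡ (negFact-order c (m<n⇒m<1+n k<n))) ⟩
    0# + rev c n * 0#                                  ≈⟨ trans (+-identityˡ _) (zeroʳ _) ⟩
    0#                                                 ∎

  fcheck-suc-suc : ∀ c v n → fcheck c v (suc (suc n)) + rev c n * fcheck c v (suc n) ≈ v * fcheck c v (suc n)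
  fcheck-suc-suc c v n = begin
    v * (p * (v - e)) + e * (v * p)  ≈⟨ +-cong (sym (*-assoc v p (v - e))) (*-comm e (v * p)) ⟩
    (v * p) * (v - e) + (v * p) * e  ≈⟨ sym (distribˡ (v * p) (v - e) e) ⟩
    (v * p) * ((v - e) + e)          ≈⟨ *-congˡ (minus-+-cancel v e) ⟩
    (v * p) * v                      ≈⟨ *-comm (v * p) v ⟩
    v * (v * p)                      ∎
    where
      p = posFact (rev c) v n
      e = rev c n

  lhsSeries-suc : ∀ c v k → lhsSeries c v (suc k) ≈ v * lhsSeries c v k
  lhsSeries-suc c v k = begin
    sumTo (λ n → A n (suc k) * F n) (suc (suc k))
      ≈⟨ trans (sumTo-suc-head _ (suc k)) (trans (+-congʳ (zeroˡ (F 0))) (+-identityˡ _)) ⟩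
    sumTo (λ n → A (suc n) (suc k) * F (suc n)) (suc k)
      ≈⟨ sumTo-cong (suc k) (λ n _ → trans (*-congʳ (negFact-suc-suc c n k))
                                  (trans (distribʳ _ _ _) (+-congˡ (xy∙z≈y∙xz _ _ _)))) ⟩
    sumTo (λ n → A n k * F (suc n) + A (suc n) k * (d n * F (suc n))) (suc k)
      ≈⟨ sumTo-+ _ _ (suc k) ⟩
    sumTo (λ n → A n k * F (suc n)) (suc k) + sumTo (λ n → A (suc n) k * (d n * F (suc n))) (suc k)
      ≈⟨ +-cong (sumTo-suc-head _ k)
                (sumTo-drop-last _ k (trans (*-congʳ (negFact-order c (n<1+n k))) (zeroˡ _))) ⟩
    (A 0 k * F 1 + sumTo (λ n → A (suc n) k * F (suc (suc n))) k)
      + sumTo (λ n → A (suc n) k * (d n * F (suc n))) k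
      ≈⟨ trans (+-assoc _ _ _) (+-congˡ (sym (sumTo-+ _ _ k))) ⟩
    A 0 k * F 1 + sumTo (λ n → A (suc n) k * F (suc (suc n)) + A (suc n) k * (d n * F (suc n))) k
      ≈⟨ +-congˡ (sumTo-cong k (λ n _ → trans (sym (distribˡ _ _ _)) (*-congˡ (fcheck-suc-suc c v n)))) ⟩
    A 0 k * (v * F 0) + sumTo (λ n → A (suc n) k * (v * F (suc n))) k
      ≈⟨ sym (sumTo-suc-head _ k) ⟩
    sumTo (λ n → A n k * (v * F n)) (suc k)
      ≈⟨ sumTo-cong (suc k) (λ n _ → x∙yz≈y∙xz _ _ _) ⟩
    sumTo (λ n → v * (A n k * F n)) (suc k)
      ≈⟨ sym (*-distribˡ-sumTo v _ (suc k)) ⟩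
    v * sumTo (λ n → A n k * F n) (suc k) ∎
    where
      A = negFact c
      F = fcheck c v
      d = rev c

  lhsSeries≈geom : ∀ c v k → lhsSeries c v k ≈ geom v k
  lhsSeries≈geom c v zero    = trans (+-identityˡ _) (*-identityʳ 1#)
  lhsSeries≈geom c v (suc k) = trans (lhsSeries-suc c v k) (*-congˡ (lhsSeries≈geom c v k))

mainTheorem3 : {a ℓ : Level} (R : CommutativeRing a ℓ) →
    let open CommutativeRing R in
    let open FPS R in
    (c : ℤ → Carrier) (v : Carrier) (k : ℕ) →
    lhsSeries c v k ≈ geom v k
mainTheorem3 R = lhsSeries≈geom R
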